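{- Let $M$ be a monoid, written additively with unit $0$ but not necessarily commutative. Define a relation $\mathcal R$ on $M$ as follows. Set $a\,\mathcal R\,b$ iff there exist finite sequences $v=(x_1,\dots,x_k)$ and $w=(y_1,\dots,y_l)$ of elements of $M$ such that: - $v$ is obtained from $w$ by deleting some of its entries while keeping the order of the remaining ones; - $a=x_1+\dots+x_k$ and $b=y_1+\dots+y_l$, where an empty sum is $0$. Let $\preceq_{\min}$ be the transitive closure of $\mathcal R$. Suppose there exists some relation $\le$ on $M$ making $M$ a positive partially ordered monoid. Then $\preceq_{\min}$ is antisymmetric. In that case, $M$ with $\preceq_{\min}$ is a positive partially ordered monoid.
   Context: A relation $\le$ on a monoid $M$ makes it a positive partially ordered monoid if it satisfies all of the following for all $a,b,c\in M$: (O) $a\le b$ and $b\le c$ imply $a\le c$; (P) $0\le a$; (C) $a\le b$ implies $a+c\le b+c$ and $c+a\le c+b$; (A) $a\le b$ and $b\le a$ imply $a=b$. -}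

module Defs where

open import Level using (Level; _⊔_; suc)
open import Data.Product using (∃; ∃₂; _×_; _,_)
open import Data.List using (List; foldr)
open import Data.List.Relation.Binary.Sublist.Propositional using (_⊆_)
open import Relation.Binary.PropositionalEquality using (_≡_)
open import Relation.Binary.Core using (Rel)
open import Relation.Binary.Construct.Closure.Transitive using (TransClosure)
open import Algebra.Structures using (IsMonoid)

module _ {a} {M : Set a} (_+_ : M → M → M) (0# : M) where

  Σ[_] : List M → M
  Σ[ xs ] = foldr _+_ 0# xs

  𝓡 : Rel M a
  𝓡 x y = ∃₂ λ (v w : List M) → (v ⊆ w) × (x ≡ Σ[ v ]) × (y ≡ Σ[ w ])

  ⪯min : Rel M a
  ⪯min = TransClosure 𝓡

  -- positive partially ordered monoid (conditions O, P, C, A)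
  record IsPosPOMonoid {ℓ} (_≤_ : Rel M ℓ) : Set (a ⊔ ℓ) where
    field
      trans   : ∀ {x y z} → x ≤ y → y ≤ z → x ≤ z
      positive : ∀ x → 0# ≤ x
      compatʳ : ∀ {x y} z → x ≤ y → (x + z) ≤ (y + z)
      compatˡ : ∀ {x y} z → x ≤ y → (z + x) ≤ (z + y)
      antisym : ∀ {x y} → x ≤ y → y ≤ x → x ≡ y

-- 1. Σ turns concatenation into +, and concatenating subsequences gives a
--    subsequence; hence 𝓡 (written _R_ below) is reflexive, relates 0
--    to everything and is compatible with + in both arguments.  Compatibility survives taking
--    the transitive closure, so ⪯min satisfies (O), (P) and (C).
-- 2. In any positive partially ordered monoid (M, ≤), Σ is monotone along
--    subsequences (deleting an entry y means using 0 ≤ y), so 𝓡 ⊆ ≤ and,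
--    since ≤ is transitive, ⪯min ⊆ ≤: ⪯min is the least such order.
-- 3. Antisymmetry of ≤ therefore transfers to ⪯min, which gives (A) and
--    completes the proof.
module Submission where

open import Defs
open import Function using (id)
open import Data.Product using (∃; _×_; _,_)
open import Data.List using (List; []; _∷_; _++_; [_])
open import Data.List.Relation.Binary.Sublist.Propositional using (_⊆_; []; _∷ʳ_; _∷_)
open import Data.List.Relation.Binary.Sublist.Propositional.Properties using (++⁺)
open import Relation.Binary.PropositionalEquality using (_≡_; refl; sym; trans; cong; subst)
open import Relation.Binary.Core using (Rel; _=[_]⇒_)
open import Relation.Binary.Construct.Closure.Transitive
  using (TransClosure; transitive⁻) renaming ([_] to ⁺[_]; _∷_ to _⁺∷_; _++_ to _⁺++_)
open import Algebra.Structures using (IsMonoid)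

closure-map : ∀ {a b ℓ₁ ℓ₂} {A : Set a} {B : Set b} {R : Rel A ℓ₁} {S : Rel B ℓ₂}
  {f : A → B} → R =[ f ]⇒ S → TransClosure R =[ f ]⇒ TransClosure S
closure-map R⇒S ⁺[ r ]     = ⁺[ R⇒S r ]
closure-map R⇒S (r ⁺∷ rs) = R⇒S r ⁺∷ closure-map R⇒S rs

module MinimalOrder {a} {M : Set a} (_+_ : M → M → M) (0# : M)
                    (isMonoid : IsMonoid _≡_ _+_ 0#) where
  open IsMonoid isMonoid using (assoc; identityˡ; identityʳ)

  Σ : List M → M
  Σ = Σ[_] _+_ 0#

  _R_ : Rel M a
  _R_ = 𝓡 _+_ 0#

  _⪯_ : Rel M a
  _⪯_ = ⪯min _+_ 0#

  Σ-++ : ∀ v w → Σ (v ++ w) ≡ Σ v + Σ w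
  Σ-++ []      w = sym (identityˡ (Σ w))
  Σ-++ (x ∷ v) w = trans (cong (x +_) (Σ-++ v w)) (sym (assoc x (Σ v) (Σ w)))

  Σ-[_] : ∀ x → Σ [ x ] ≡ x
  Σ-[ x ] = identityʳ x

  R-refl : ∀ x → x R x
  R-refl x = [ x ] , [ x ] , refl ∷ [] , sym Σ-[ x ] , sym Σ-[ x ]

  R-zero : ∀ x → 0# R x
  R-zero x = [] , [ x ] , x ∷ʳ [] , refl , sym Σ-[ x ]

  R-+ : ∀ {x y u v} → x R y → u R v → (x + u) R (y + v)
  R-+ (v₁ , w₁ , v₁⊆w₁ , refl , refl) (v₂ , w₂ , v₂⊆w₂ , refl , refl) =
    v₁ ++ v₂ , w₁ ++ w₂ , ++⁺ v₁⊆w₁ v₂⊆w₂ , sym (Σ-++ v₁ v₂) , sym (Σ-++ w₁ w₂)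

  ⪯-compatˡ : ∀ {x y} z → x ⪯ y → (z + x) ⪯ (z + y)
  ⪯-compatˡ z = closure-map (R-+ (R-refl z))

  ⪯-compatʳ : ∀ {x y} z → x ⪯ y → (x + z) ⪯ (y + z)
  ⪯-compatʳ z = closure-map (λ r → R-+ r (R-refl z))

  module LeastOrder {ℓ} {_≤_ : Rel M ℓ} (isPos : IsPosPOMonoid _+_ 0# _≤_) where
    open IsPosPOMonoid isPos renaming (trans to ≤-trans)

    ≤-refl : ∀ x → x ≤ x
    ≤-refl x = subst (λ u → u ≤ u) (identityˡ x) (compatʳ x (positive 0#))

    x≤y+x : ∀ x y → x ≤ (y + x)
    x≤y+x x y = subst (_≤ (y + x)) (identityˡ x) (compatʳ x (positive y))

    Σ-mono : ∀ {v w} → v ⊆ w → Σ v ≤ Σ w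
    Σ-mono []           = ≤-refl 0#
    Σ-mono (y ∷ʳ v⊆w)   = ≤-trans (Σ-mono v⊆w) (x≤y+x _ y)
    Σ-mono (refl ∷ v⊆w) = compatˡ _ (Σ-mono v⊆w)

    R⇒≤ : ∀ {x y} → x R y → x ≤ y
    R⇒≤ (v , w , v⊆w , refl , refl) = Σ-mono v⊆w

    ⪯⇒≤ : ∀ {x y} → x ⪯ y → x ≤ y
    ⪯⇒≤ p = transitive⁻ _≤_ ≤-trans (closure-map {f = id} R⇒≤ p)

    ⪯-antisym : ∀ {x y} → x ⪯ y → y ⪯ x → x ≡ y
    ⪯-antisym p q = antisym (⪯⇒≤ p) (⪯⇒≤ q)

proposition1 : ∀ {a ℓ} {M : Set a} (_+_ : M → M → M) (0# : M) →
    IsMonoid _≡_ _+_ 0# →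
    (∃ λ (_≤_ : Rel M ℓ) → IsPosPOMonoid _+_ 0# _≤_) →
    (∀ {x y} → ⪯min _+_ 0# x y → ⪯min _+_ 0# y x → x ≡ y)
      × IsPosPOMonoid _+_ 0# (⪯min _+_ 0#)
proposition1 _+_ 0# isMonoid (_ , isPos) = ⪯-antisym , record
  { trans    = _⁺++_
  ; positive = λ x → ⁺[ R-zero x ]
  ; compatʳ  = ⪯-compatʳ
  ; compatˡ  = ⪯-compatˡ
  ; antisym  = ⪯-antisym
  }
  where
  open MinimalOrder _+_ 0# isMonoid
  open LeastOrder isPos using (⪯-antisym)
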